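{- Let $T$ be a finite tree, let $\{S_i\}_{i=1}^k$ be a starlike decomposition of $T$ resulting from a sequence of starlike splittings of which $\iota$ are irregular, and let $\ell_i$ be the number of leaves of $S_i$. Then (a) $\sum_{i=1}^k(\ell_i-2)=\ell(T)-2-\iota$, where $\ell(T)$ is the number of leaves of $T$; (b) $\sum_{i=1}^k(\ell_i-2)$ is independent of the choice of starlike decomposition of $T$; (c) $\iota$ is independent of the sequence of starlike splittings.
   Context: A starlike tree is a tree with exactly one vertex of degree at least $3$ (its central vertex). If a tree $T$ has at least two vertices of degree at least $3$, a starlike splitting of $T$ is a $4$-tuple $(S,T',v_s,v_t)$ where $S$ is a starlike tree, $T'$ is a tree, $v_s$ is a leaf of $S$ adjacent to the central vertex of $S$, $v_t\in V(T')$, and $T$ is obtained from $S$ and $T'$ by identifying $v_s$ with $v_t$. The splitting is regular if $v_t$ has degree $1$ in $T'$ and irregular if $v_t$ has degree greater than $1$ in $T'$. A starlike decomposition of a tree $T$ results from a sequence of starlike splittings: if $T$ is a starlike tree or a path graph, its only starlike decomposition is $\{T\}$ (with no splittings); otherwise, for a starlike splitting $(S_1,T',v_s,v_t)$ of $T$ and a starlike decomposition $\{S_2,\dots,S_k\}$ of $T'$ (obtained by a further sequence of splittings), $\{S_1,\dots,S_k\}$ is a starlike decomposition of $T$, resulting from the splitting of $T$ followed by the splittings of $T'$. -}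

module Defs where

open import Data.Nat using (ℕ; zero; suc; _+_; _≤_; _<_)
open import Data.Integer as ℤ using (ℤ; +_)
open import Data.Fin using (Fin; zero; suc; inject₁; fromℕ)
open import Data.Bool using (Bool; true; false; T)
open import Data.List using (List; []; _∷_; map; allFin)
open import Data.Product using (Σ; _×_; ∃; ∃-syntax; _,_)
open import Data.Sum using (_⊎_)
open import Relation.Nullary using (¬_)
open import Relation.Binary.PropositionalEquality using (_≡_; _≢_)
open import Relation.Binary.Construct.Closure.ReflexiveTransitive using (Star)
open import Function.Definitions using (Injective)

record Graph (n : ℕ) : Set where
  field
    adj    : Fin n → Fin n → Bool
    sym    : ∀ u v → adj u v ≡ adj v u
    irrefl : ∀ v → adj v v ≡ false
open Graph public

Adj : ∀ {n} → Graph n → Fin n → Fin n → Set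
Adj G u v = T (adj G u v)

countTrue : List Bool → ℕ
countTrue []            = 0
countTrue (true ∷ bs)   = suc (countTrue bs)
countTrue (false ∷ bs)  = countTrue bs

degree : ∀ {n} → Graph n → Fin n → ℕ
degree {n} G v = countTrue (map (adj G v) (allFin n))

Connected : ∀ {n} → Graph n → Set
Connected {n} G = ∀ (u v : Fin n) → Star (Adj G) u v

HasCycle : ∀ {n} → Graph n → Set
HasCycle {n} G =
  Σ ℕ λ k → Σ (Fin (suc (suc (suc k))) → Fin n) λ c →
    Injective _≡_ _≡_ c
    × (∀ (i : Fin (suc (suc k))) → Adj G (c (inject₁ i)) (c (suc i)))
    × Adj G (c (fromℕ (suc (suc k)))) (c zero)

record Tree : Set where
  field
    size      : ℕ
    graph     : Graph size
    nonempty  : 1 ≤ size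
    connected : Connected graph
    acyclic   : ¬ HasCycle graph
open Tree public

V : Tree → Set
V t = Fin (size t)

deg : (t : Tree) → V t → ℕ
deg t = degree (graph t)

IsLeaf : (t : Tree) → V t → Set
IsLeaf t v = deg t v ≡ 1

isLeafB : (t : Tree) → V t → Bool
isLeafB t v with deg t v
... | 1 = true
... | _ = false

leaves : Tree → ℕ
leaves t = countTrue (map (isLeafB t) (allFin (size t)))

IsCenter : (t : Tree) → V t → Set
IsCenter t c = 3 ≤ deg t c × (∀ v → 3 ≤ deg t v → v ≡ c)

Starlike : Tree → Set
Starlike t = ∃[ c ] IsCenter t c

IsPath : Tree → Set
IsPath t = ∀ v → deg t v ≤ 2

TwoBranchVertices : Tree → Set
TwoBranchVertices t = Σ (V t) λ u → Σ (V t) λ v → u ≢ v × 3 ≤ deg t u × 3 ≤ deg t v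

-- t is obtained from s and t' by identifying vs with vt:
-- embeddings f, g of s and t' into t, jointly surjective, overlapping exactly in
-- f vs = g vt, preserving and reflecting adjacency, and every edge of t lies in
-- one of the two images.
Glue : (t s t' : Tree) → V s → V t' → Set
Glue t s t' vs vt =
  Σ (V s → V t) λ f → Σ (V t' → V t) λ g →
    Injective _≡_ _≡_ f × Injective _≡_ _≡_ g
    × f vs ≡ g vt
    × (∀ x y → f x ≡ g y → x ≡ vs × y ≡ vt)
    × (∀ w → (∃[ x ] f x ≡ w) ⊎ (∃[ y ] g y ≡ w))
    × (∀ x y → adj (graph t) (f x) (f y) ≡ adj (graph s) x y)
    × (∀ x y → adj (graph t) (g x) (g y) ≡ adj (graph t') x y)
    × (∀ u w → Adj (graph t) u w →
         (Σ (V s) λ x → Σ (V s) λ y → f x ≡ u × f y ≡ w)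
         ⊎ (Σ (V t') λ x → Σ (V t') λ y → g x ≡ u × g y ≡ w))

record Splitting (t s t' : Tree) (vs : V s) (vt : V t') : Set where
  field
    branching : TwoBranchVertices t
    center    : V s
    isCenter  : IsCenter s center
    vsLeaf    : IsLeaf s vs
    vsAdjC    : Adj (graph s) center vs
    glue      : Glue t s t' vs vt

irregularity : (t' : Tree) → V t' → ℕ
irregularity t' vt with deg t' vt
... | suc (suc _) = 1
... | _           = 0

data Decomp : Tree → List Tree → ℕ → Set where
  base-star : ∀ {t} → Starlike t → Decomp t (t ∷ []) 0
  base-path : ∀ {t} → IsPath t → Decomp t (t ∷ []) 0
  split     : ∀ {t s t' vs vt Ss ι} → Splitting t s t' vs vt → Decomp t' Ss ι →
              Decomp t (s ∷ Ss) (irregularity t' vt + ι)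

leafExcess : List Tree → ℤ
leafExcess []       = + 0
leafExcess (s ∷ Ss) = (+ leaves s ℤ.- + 2) ℤ.+ leafExcess Ss

-- For one splitting of T into S and T', the leaves satisfy ℓ(S) + ℓ(T') + [irregular] = ℓ(T) + 2: the glued
-- leaf vs of S disappears, and vt is a leaf of T' exactly when the splitting is regular. Summing gives (a).
-- For (c), ι is characterised intrinsically as the largest number of distinct edges of T such that every vertex v
-- lies on at most deg v − 2 of them (an "excess matching"). Such edges join two branch vertices, so starlike trees
-- and paths have none. Across a splitting the maximum grows by exactly the irregularity: an excess matching of T'
-- maps into T and, when vt keeps degree at least 2 in T', can be extended by the edge from the centre of S to vt;
-- conversely an excess matching of T contains at most one such edge, and once it is removed the rest restricts to
-- T' after dropping at most one edge at vt. (b) follows from (a) and (c).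
module Submission where

open import Defs hiding (sym)
open import Data.Bool.Properties using (T-≡; ∨-comm; ∨-zeroʳ)
open import Data.Bool using (Bool; true; false; T; _∨_; if_then_else_)
open import Data.Empty using (⊥-elim)
open import Data.Integer as ℤ using (ℤ; +_; _-_)
open import Data.Integer.Properties using (pos-+)
open import Data.Integer.Tactic.RingSolver using (solve-∀)
open import Data.Fin using (Fin; zero; suc; _≟_)
open import Data.List using (List; []; _∷_; map; allFin; filter; length; _++_)
open import Data.List.Properties using (length-map; length-++; map-cong; map-∘)
open import Data.List.Membership.Propositional using (_∈_)
open import Data.List.Membership.Propositional.Properties
  using (∈-filter⁺; ∈-filter⁻; ∈-map⁺; ∈-map⁻; ∈-++⁺ˡ; ∈-++⁺ʳ; ∈-++⁻; ∈-allFin)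
open import Data.List.Membership.Propositional.Properties.WithK using (unique∧set⇒bag)
open import Data.List.Relation.Binary.BagAndSetEquality using (∼bag⇒↭)
open import Data.List.Relation.Binary.Disjoint.Propositional using (Disjoint)
open import Data.List.Relation.Binary.Permutation.Propositional.Properties using (↭-length)
open import Data.List.Relation.Binary.Sublist.Propositional using (_⊆_; []; _∷_; _∷ʳ_; ⊆-refl)
open import Data.List.Relation.Binary.Sublist.Propositional.Properties using (All-resp-⊆)
open import Data.List.Relation.Ternary.Interleaving.Propositional using (Interleaving; consˡ; consʳ)
open import Data.List.Relation.Ternary.Interleaving using ([])
import Data.List.Relation.Ternary.Interleaving as Interleaving
open import Data.List.Relation.Ternary.Interleaving.Properties using (interleave-length)
open import Data.List.Relation.Unary.All using (All; []; _∷_)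
open import Data.List.Relation.Unary.AllPairs using (AllPairs; []; _∷_)
import Data.List.Relation.Unary.All as All
import Data.List.Relation.Unary.All.Properties as All
import Data.List.Relation.Unary.AllPairs as AllPairs
import Data.List.Relation.Unary.AllPairs.Properties as AllPairs
open import Data.List.Relation.Unary.Unique.Propositional using (Unique)
import Data.List.Relation.Unary.Unique.Propositional.Properties as Unique
open import Data.Nat using (ℕ; zero; suc; _+_; _∸_; _≤_; z≤n; s≤s; _≡ᵇ_)
open import Data.Nat.Properties
  using ( +-identityʳ; +-comm; +-assoc; +-suc; n≤1+n; ≤-refl; ≤-reflexive; ≤-trans; ≤-pred
        ; ≤-antisym; ≤⇒≯; m<n⇒n≢0; m∸n≢0⇒n<m; m<n⇒0<n∸m; ∸-monoˡ-≤; +-∸-assoc; +-monoʳ-≤)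
open import Data.Product using (Σ; _×_; ∃; ∃-syntax; _,_; proj₁; proj₂; swap; uncurry)
open import Data.Sum using (_⊎_; inj₁; inj₂)
open import Data.Unit using (tt)
open import Function.Bundles using (mk⇔; Equivalence)
open import Function.Definitions using (Injective)
open import Relation.Nullary using (¬_; does; yes; no)
open import Relation.Nullary.Decidable using (T?)
open import Relation.Binary.Construct.Closure.ReflexiveTransitive using (ε; _◅_)
open import Relation.Binary.PropositionalEquality
  using (_≡_; _≢_; refl; sym; trans; cong; cong₂; subst; subst₂; module ≡-Reasoning)

count : ∀ {n} → (Fin n → Bool) → ℕ
count {n} P = countTrue (map P (allFin n))

support : ∀ {n} → (Fin n → Bool) → List (Fin n)
support {n} P = filter (λ x → T? (P x)) (allFin n)

countTrue-map≡length-filter : ∀ {A : Set} (P : A → Bool) xs →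
  countTrue (map P xs) ≡ length (filter (λ x → T? (P x)) xs)
countTrue-map≡length-filter P [] = refl
countTrue-map≡length-filter P (x ∷ xs) with P x
... | true  = cong suc (countTrue-map≡length-filter P xs)
... | false = countTrue-map≡length-filter P xs

∈-support⁺ : ∀ {n} {P : Fin n → Bool} {x} → P x ≡ true → x ∈ support P
∈-support⁺ {P = P} {x} Px = ∈-filter⁺ (λ x → T? (P x)) (∈-allFin x) (subst T (sym Px) tt)

∈-support⁻ : ∀ {n} {P : Fin n → Bool} {x} → x ∈ support P → P x ≡ true
∈-support⁻ {n} {P} {x} x∈ with P x | proj₂ (∈-filter⁻ (λ x → T? (P x)) {xs = allFin n} x∈)
... | true | _ = refl

count-⊎-image : ∀ {n m₁ m₂} (P : Fin n → Bool)
  {h₁ : Fin m₁ → Fin n} {Q₁ : Fin m₁ → Bool} {h₂ : Fin m₂ → Fin n} {Q₂ : Fin m₂ → Bool} →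
  Injective _≡_ _≡_ h₁ → Injective _≡_ _≡_ h₂ →
  (∀ y → Q₁ y ≡ true → P (h₁ y) ≡ true) → (∀ z → Q₂ z ≡ true → P (h₂ z) ≡ true) →
  (∀ y z → Q₁ y ≡ true → Q₂ z ≡ true → h₁ y ≢ h₂ z) →
  (∀ x → P x ≡ true → (∃ λ y → h₁ y ≡ x × Q₁ y ≡ true) ⊎ (∃ λ z → h₂ z ≡ x × Q₂ z ≡ true)) →
  count P ≡ count Q₁ + count Q₂
count-⊎-image {n} P {h₁} {Q₁} {h₂} {Q₂} h₁-inj h₂-inj into₁ into₂ disjoint cover = begin
  count P                                           ≡⟨ countTrue-map≡length-filter P (allFin n) ⟩
  length (support P)                                ≡⟨ ↭-length (∼bag⇒↭ support≈images) ⟩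
  length (map h₁ (support Q₁) ++ map h₂ (support Q₂)) ≡⟨ length-++ (map h₁ (support Q₁)) ⟩
  length (map h₁ (support Q₁)) + length (map h₂ (support Q₂))
    ≡⟨ cong₂ _+_ (trans (length-map h₁ (support Q₁)) (sym (countTrue-map≡length-filter Q₁ (allFin _))))
                 (trans (length-map h₂ (support Q₂)) (sym (countTrue-map≡length-filter Q₂ (allFin _)))) ⟩
  count Q₁ + count Q₂                                ∎
  where
  open ≡-Reasoning
  images = map h₁ (support Q₁) ++ map h₂ (support Q₂)
  unique-support : ∀ {m} (Q : Fin m → Bool) → Unique (support Q)
  unique-support {m} Q = Unique.filter⁺ (λ x → T? (Q x)) (Unique.allFin⁺ m)
  images-disjoint : Disjoint (map h₁ (support Q₁)) (map h₂ (support Q₂))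
  images-disjoint (a , b) with ∈-map⁻ h₁ a | ∈-map⁻ h₂ b
  ... | y , y∈ , refl | z , z∈ , eq = disjoint y z (∈-support⁻ y∈) (∈-support⁻ z∈) eq
  to : ∀ {x} → x ∈ support P → x ∈ images
  to {x} x∈ with cover x (∈-support⁻ x∈)
  ... | inj₁ (y , refl , Q₁y) = ∈-++⁺ˡ (∈-map⁺ h₁ (∈-support⁺ Q₁y))
  ... | inj₂ (z , refl , Q₂z) = ∈-++⁺ʳ (map h₁ (support Q₁)) (∈-map⁺ h₂ (∈-support⁺ Q₂z))
  from : ∀ {x} → x ∈ images → x ∈ support P
  from x∈ with ∈-++⁻ (map h₁ (support Q₁)) x∈
  ... | inj₁ a with ∈-map⁻ h₁ a
  ...   | y , y∈ , refl = ∈-support⁺ (into₁ y (∈-support⁻ y∈))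
  from x∈ | inj₂ b with ∈-map⁻ h₂ b
  ...   | z , z∈ , refl = ∈-support⁺ (into₂ z (∈-support⁻ z∈))
  support≈images = unique∧set⇒bag (unique-support P)
    (Unique.++⁺ (Unique.map⁺ h₁-inj (unique-support Q₁)) (Unique.map⁺ h₂-inj (unique-support Q₂))
      images-disjoint)
    (mk⇔ to from)

count-image : ∀ {n m} (P : Fin n → Bool) {h : Fin m → Fin n} {Q : Fin m → Bool} →
  Injective _≡_ _≡_ h → (∀ y → Q y ≡ true → P (h y) ≡ true) →
  (∀ x → P x ≡ true → ∃ λ y → h y ≡ x × Q y ≡ true) →
  count P ≡ count Q
count-image P {Q = Q} h-inj into cover =
  trans (count-⊎-image {m₂ = 0} P {h₂ = λ ()} {Q₂ = λ ()} h-inj (λ {}) into (λ ()) (λ _ ())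
                       (λ x Px → inj₁ (cover x Px)))
        (+-identityʳ (count Q))

without : ∀ {n} → Fin n → (Fin n → Bool) → Fin n → Bool
without a P x = if does (x ≟ a) then false else P x

without-other : ∀ {n} {a x : Fin n} P → x ≢ a → without a P x ≡ P x
without-other {a = a} {x} P x≢a with x ≟ a
... | yes x≡a = ⊥-elim (x≢a x≡a)
... | no _    = refl

without-true : ∀ {n} {a x : Fin n} P → without a P x ≡ true → x ≢ a × P x ≡ true
without-true {a = a} {x} P eq with x ≟ a
... | no x≢a = x≢a , eq

count-erase-member : ∀ {n} (P : Fin n → Bool) {a} → P a ≡ true → count P ≡ suc (count (without a P))
count-erase-member P {a} Pa =
  trans (count-⊎-image P {h₁ = λ x → x} {Q₁ = without a P} {h₂ = λ (_ : Fin 1) → a} {Q₂ = λ _ → true}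
          (λ eq → eq) (λ { {zero} {zero} _ → refl })
          (λ x eq → proj₂ (without-true P eq)) (λ _ _ → Pa)
          (λ y _ eq _ → proj₁ (without-true P eq))
          cover)
        (+-comm (count (without a P)) 1)
  where
  cover : ∀ x → P x ≡ true → (∃ λ y → y ≡ x × without a P y ≡ true) ⊎ (∃ λ (z : Fin 1) → a ≡ x × true ≡ true)
  cover x Px with x ≟ a
  ... | yes refl = inj₂ (zero , refl , refl)
  ... | no x≢a   = inj₁ (x , refl , trans (without-other P x≢a) Px)

count-erase-nonmember : ∀ {n} (P : Fin n → Bool) {a} → P a ≡ false → count P ≡ count (without a P)
count-erase-nonmember {n} P {a} Pa = cong countTrue (map-cong agree (allFin n))
  where
  agree : ∀ x → P x ≡ without a P x
  agree x with x ≟ a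
  ... | yes refl = Pa
  ... | no _     = refl

¬Adj-refl : ∀ {n} (G : Graph n) v → ¬ Adj G v v
¬Adj-refl G v = subst T (irrefl G v)

isLeafB≡deg≡ᵇ1 : ∀ t v → isLeafB t v ≡ (deg t v ≡ᵇ 1)
isLeafB≡deg≡ᵇ1 t v with deg t v
... | zero        = refl
... | suc zero    = refl
... | suc (suc _) = refl

adjacent⇒deg-pos : ∀ t {u w} → Adj (graph t) u w → 1 ≤ deg t u
adjacent⇒deg-pos t {u} uw rewrite count-erase-member (adj (graph t) u) (Equivalence.to T-≡ uw) = s≤s z≤n

nontrivial⇒deg-pos : ∀ t {u w} → u ≢ w → 1 ≤ deg t u
nontrivial⇒deg-pos t {u} {w} u≢w with connected t u w
... | ε      = ⊥-elim (u≢w refl)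
... | uv ◅ _ = adjacent⇒deg-pos t uv

leaves+irregularity : ∀ t v → 1 ≤ deg t v → leaves t + irregularity t v ≡ suc (count (without v (isLeafB t)))
leaves+irregularity t v d≥1 with deg t v in d≡
... | suc zero =
  trans (+-identityʳ (leaves t))
        (count-erase-member (isLeafB t) (trans (isLeafB≡deg≡ᵇ1 t v) (cong (_≡ᵇ 1) d≡)))
... | suc (suc _) =
  trans (cong (_+ 1) (count-erase-nonmember (isLeafB t) (trans (isLeafB≡deg≡ᵇ1 t v) (cong (_≡ᵇ 1) d≡))))
        (+-comm _ 1)

irregularity-cases : ∀ t v → 1 ≤ deg t v →
  (deg t v ≡ 1 × irregularity t v ≡ 0) ⊎ (2 ≤ deg t v × irregularity t v ≡ 1)
irregularity-cases t v d≥1 with deg t v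
... | suc zero    = inj₁ (refl , refl)
... | suc (suc _) = inj₂ (s≤s (s≤s z≤n) , refl)

suc[deg]∸2≡irregularity+[deg∸2] : ∀ t v → suc (deg t v) ∸ 2 ≡ irregularity t v + (deg t v ∸ 2)
suc[deg]∸2≡irregularity+[deg∸2] t v with deg t v
... | zero        = refl
... | suc zero    = refl
... | suc (suc _) = refl

record Gluing (t s t' : Tree) (vs : V s) (vt : V t') : Set where
  field
    f           : V s → V t
    g           : V t' → V t
    f-injective : Injective _≡_ _≡_ f
    g-injective : Injective _≡_ _≡_ g
    f-vs≡g-vt   : f vs ≡ g vt
    f≡g⇒junction     : ∀ x y → f x ≡ g y → x ≡ vs × y ≡ vt
    cover       : ∀ w → (∃[ x ] f x ≡ w) ⊎ (∃[ y ] g y ≡ w)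
    adj-f       : ∀ x y → adj (graph t) (f x) (f y) ≡ adj (graph s) x y
    adj-g       : ∀ x y → adj (graph t) (g x) (g y) ≡ adj (graph t') x y
    edge-cover  : ∀ u w → Adj (graph t) u w →
                    (Σ (V s) λ x → Σ (V s) λ y → f x ≡ u × f y ≡ w)
                    ⊎ (Σ (V t') λ x → Σ (V t') λ y → g x ≡ u × g y ≡ w)

fromGlue : ∀ {t s t' vs vt} → Glue t s t' vs vt → Gluing t s t' vs vt
fromGlue (f , g , f-inj , g-inj , fg , ov , cv , af , ag , ec) = record
  { f = f ; g = g ; f-injective = f-inj ; g-injective = g-inj ; f-vs≡g-vt = fg
  ; f≡g⇒junction = ov ; cover = cv ; adj-f = af ; adj-g = ag ; edge-cover = ec }

module Glued {t s t' : Tree} {vs : V s} {vt : V t'} (G : Gluing t s t' vs vt) where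
  open Gluing G public

  ∀-vertex : {P : V t → Set} → (∀ y → P (g y)) → (∀ x → x ≢ vs → P (f x)) → ∀ w → P w
  ∀-vertex {P} Pg Pf w with cover w
  ... | inj₂ (y , refl) = Pg y
  ... | inj₁ (x , refl) with x ≟ vs
  ...   | yes refl = subst P (sym f-vs≡g-vt) (Pg vt)
  ...   | no x≢vs  = Pf x x≢vs

  f≢g : ∀ {x} → x ≢ vs → ∀ y → f x ≢ g y
  f≢g x≢vs y eq = x≢vs (proj₁ (f≡g⇒junction _ y eq))

  deg-f : ∀ {x} → x ≢ vs → deg t (f x) ≡ deg s x
  deg-f {x} x≢vs = count-image (adj (graph t) (f x)) f-injective (λ y → trans (adj-f x y)) neighbours
    where
    neighbours : ∀ w → adj (graph t) (f x) w ≡ true → ∃ λ y → f y ≡ w × adj (graph s) x y ≡ true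
    neighbours w fx~w with edge-cover (f x) w (Equivalence.from T-≡ fx~w)
    ... | inj₁ (_ , y , _ , refl)  = y , refl , trans (sym (adj-f x y)) fx~w
    ... | inj₂ (x' , _ , fx≡gx' , _) = ⊥-elim (f≢g x≢vs x' (sym fx≡gx'))

  deg-g : ∀ {y} → y ≢ vt → deg t (g y) ≡ deg t' y
  deg-g {y} y≢vt = count-image (adj (graph t) (g y)) g-injective (λ z → trans (adj-g y z)) neighbours
    where
    neighbours : ∀ w → adj (graph t) (g y) w ≡ true → ∃ λ z → g z ≡ w × adj (graph t') y z ≡ true
    neighbours w gy~w with edge-cover (g y) w (Equivalence.from T-≡ gy~w)
    ... | inj₂ (_ , z , _ , refl)  = z , refl , trans (sym (adj-g y z)) gy~w
    ... | inj₁ (x , _ , fx≡gy , _) = ⊥-elim (y≢vt (proj₂ (f≡g⇒junction x y fx≡gy)))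

  isLeafB-f : ∀ {x} → x ≢ vs → isLeafB t (f x) ≡ isLeafB s x
  isLeafB-f {x} x≢vs =
    trans (isLeafB≡deg≡ᵇ1 t (f x)) (trans (cong (_≡ᵇ 1) (deg-f x≢vs)) (sym (isLeafB≡deg≡ᵇ1 s x)))

  isLeafB-g : ∀ {y} → y ≢ vt → isLeafB t (g y) ≡ isLeafB t' y
  isLeafB-g {y} y≢vt =
    trans (isLeafB≡deg≡ᵇ1 t (g y)) (trans (cong (_≡ᵇ 1) (deg-g y≢vt)) (sym (isLeafB≡deg≡ᵇ1 t' y)))

  deg-junction : deg t (g vt) ≡ deg s vs + deg t' vt
  deg-junction = count-⊎-image (adj (graph t) (g vt)) f-injective g-injective
    (λ x vs~x → trans (cong (λ u → adj (graph t) u (f x)) (sym f-vs≡g-vt)) (trans (adj-f vs x) vs~x))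
    (λ y vt~y → trans (adj-g vt y) vt~y)
    (λ x y vs~x _ fx≡gy → not-loop (proj₁ (f≡g⇒junction x y fx≡gy)) vs~x)
    neighbours
    where
    not-loop : ∀ {x} → x ≡ vs → adj (graph s) vs x ≢ true
    not-loop refl vs~vs = ¬Adj-refl (graph s) vs (Equivalence.from T-≡ vs~vs)
    neighbours : ∀ w → adj (graph t) (g vt) w ≡ true →
      (∃ λ x → f x ≡ w × adj (graph s) vs x ≡ true) ⊎ (∃ λ y → g y ≡ w × adj (graph t') vt y ≡ true)
    neighbours w vt~w with edge-cover (g vt) w (Equivalence.from T-≡ vt~w)
    ... | inj₁ (_ , x , _ , refl) =
      inj₁ (x , refl , trans (sym (adj-f vs x)) (trans (cong (λ u → adj (graph t) u (f x)) f-vs≡g-vt) vt~w))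
    ... | inj₂ (_ , y , _ , refl) = inj₂ (y , refl , trans (sym (adj-g vt y)) vt~w)

Edge : ℕ → Set
Edge n = Fin n × Fin n

mapEdge : ∀ {m n} → (Fin m → Fin n) → Edge m → Edge n
mapEdge h (a , b) = h a , h b

touches : ∀ {n} → Fin n → Edge n → Bool
touches v (a , b) = does (v ≟ a) ∨ does (v ≟ b)

load : ∀ {n} → Fin n → List (Edge n) → ℕ
load v E = countTrue (map (touches v) E)

SameEdge : ∀ {n} → Edge n → Edge n → Set
SameEdge e e' = e ≡ e' ⊎ e ≡ swap e'

Distinct : ∀ {n} → List (Edge n) → Set
Distinct = AllPairs (λ e e' → ¬ SameEdge e e')

-- Edges are ordered pairs, and SameEdge identifies the two orientations. As ∸ truncates, a vertex of degree at
-- most 2 lies on no edge of an excess matching.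
record ExcessMatching (t : Tree) (E : List (Edge (size t))) : Set where
  field
    edges    : All (uncurry (Adj (graph t))) E
    distinct : Distinct E
    load≤    : ∀ v → load v E ≤ deg t v ∸ 2

record ExcessMatchingNumber (t : Tree) (m : ℕ) : Set where
  field
    witness  : List (Edge (size t))
    matching : ExcessMatching t witness
    length≡  : length witness ≡ m
    maximal  : ∀ E → ExcessMatching t E → length E ≤ m

excessMatchingNumber-unique : ∀ {t m m'} → ExcessMatchingNumber t m → ExcessMatchingNumber t m' → m ≡ m'
excessMatchingNumber-unique ν ν' = ≤-antisym
  (subst (_≤ _) (ExcessMatchingNumber.length≡ ν) (ExcessMatchingNumber.maximal ν' _ (ExcessMatchingNumber.matching ν)))
  (subst (_≤ _) (ExcessMatchingNumber.length≡ ν') (ExcessMatchingNumber.maximal ν _ (ExcessMatchingNumber.matching ν')))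

touches-fst : ∀ {n} (a b : Fin n) → touches a (a , b) ≡ true
touches-fst a b with a ≟ a
... | yes _  = refl
... | no a≢a = ⊥-elim (a≢a refl)

touches-snd : ∀ {n} (a b : Fin n) → touches b (a , b) ≡ true
touches-snd a b with b ≟ b
... | yes _  = ∨-zeroʳ (does (b ≟ a))
... | no b≢b = ⊥-elim (b≢b refl)

touches-≢ : ∀ {n} {v a b : Fin n} → v ≢ a → v ≢ b → touches v (a , b) ≡ false
touches-≢ {v = v} {a} {b} v≢a v≢b with v ≟ a | v ≟ b
... | yes v≡a | _        = ⊥-elim (v≢a v≡a)
... | no _    | yes v≡b  = ⊥-elim (v≢b v≡b)
... | no _    | no _     = refl

touches-swap : ∀ {n} (v : Fin n) e → touches v (swap e) ≡ touches v e
touches-swap v (a , b) = ∨-comm (does (v ≟ b)) (does (v ≟ a))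

touches-mapEdge : ∀ {m n} {h : Fin m → Fin n} → Injective _≡_ _≡_ h → ∀ y e → touches (h y) (mapEdge h e) ≡ touches y e
touches-mapEdge {h = h} h-inj y (a , b) = cong₂ _∨_ (does-h a) (does-h b)
  where
  does-h : ∀ a → does (h y ≟ h a) ≡ does (y ≟ a)
  does-h a with h y ≟ h a | y ≟ a
  ... | yes _     | yes _    = refl
  ... | no _      | no _     = refl
  ... | yes hy≡ha | no y≢a   = ⊥-elim (y≢a (h-inj hy≡ha))
  ... | no hy≢ha  | yes refl = ⊥-elim (hy≢ha refl)

load-∷-touching : ∀ {n} (v : Fin n) e E → touches v e ≡ true → load v (e ∷ E) ≡ suc (load v E)
load-∷-touching v e E hit rewrite hit = refl

load-∷-¬touching : ∀ {n} (v : Fin n) e E → touches v e ≡ false → load v (e ∷ E) ≡ load v E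
load-∷-¬touching v e E miss rewrite miss = refl

load-∷-≤ : ∀ {n} (v : Fin n) e E → load v E ≤ load v (e ∷ E)
load-∷-≤ v e E with touches v e
... | true  = n≤1+n (load v E)
... | false = ≤-refl

load-mapEdge : ∀ {m n} {h : Fin m → Fin n} → Injective _≡_ _≡_ h → ∀ y E → load (h y) (map (mapEdge h) E) ≡ load y E
load-mapEdge {h = h} h-inj y E =
  cong countTrue (trans (sym (map-∘ E)) (map-cong (touches-mapEdge h-inj y) E))

load-mapEdge-outside : ∀ {m n} {h : Fin m → Fin n} {w} → (∀ y → h y ≢ w) → ∀ E → load w (map (mapEdge h) E) ≡ 0
load-mapEdge-outside w∉ [] = refl
load-mapEdge-outside w∉ ((a , b) ∷ E)
  rewrite touches-≢ (λ w≡ha → w∉ a (sym w≡ha)) (λ w≡hb → w∉ b (sym w≡hb)) = load-mapEdge-outside w∉ E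

load-copies-touching : ∀ {n} (v : Fin n) {e} {J} → All (λ j → SameEdge j e) J → touches v e ≡ true → load v J ≡ length J
load-copies-touching v [] hit = refl
load-copies-touching v (inj₁ refl ∷ J≈) hit rewrite hit = cong suc (load-copies-touching v J≈ hit)
load-copies-touching v {e} (inj₂ refl ∷ J≈) hit rewrite touches-swap v e | hit = cong suc (load-copies-touching v J≈ hit)

load-copies-¬touching : ∀ {n} (v : Fin n) {e} {J} → All (λ j → SameEdge j e) J → touches v e ≡ false → load v J ≡ 0
load-copies-¬touching v [] miss = refl
load-copies-¬touching v (inj₁ refl ∷ J≈) miss rewrite miss = load-copies-¬touching v J≈ miss
load-copies-¬touching v {e} (inj₂ refl ∷ J≈) miss rewrite touches-swap v e | miss = load-copies-¬touching v J≈ miss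

SameEdge-mapEdge⁻ : ∀ {m n} {h : Fin m → Fin n} → Injective _≡_ _≡_ h → ∀ {e e'} → SameEdge (mapEdge h e) (mapEdge h e') → SameEdge e e'
SameEdge-mapEdge⁻ h-inj {a , b} {a' , b'} (inj₁ eq) with h-inj (cong proj₁ eq) | h-inj (cong proj₂ eq)
... | refl | refl = inj₁ refl
SameEdge-mapEdge⁻ h-inj {a , b} {a' , b'} (inj₂ eq) with h-inj (cong proj₁ eq) | h-inj (cong proj₂ eq)
... | refl | refl = inj₂ refl

Distinct-map⁺ : ∀ {m n} {h : Fin m → Fin n} → Injective _≡_ _≡_ h → ∀ {E} → Distinct E → Distinct (map (mapEdge h) E)
Distinct-map⁺ h-inj E! = AllPairs.map⁺ (AllPairs.map (λ e≉e' same → e≉e' (SameEdge-mapEdge⁻ h-inj same)) E!)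

Distinct-map⁻ : ∀ {m n} {h : Fin m → Fin n} {E} → Distinct (map (mapEdge h) E) → Distinct E
Distinct-map⁻ {h = h} hE! = AllPairs.map (λ he≉he' same → he≉he' (sameEdge-mapEdge same)) (AllPairs.map⁻ hE!)
  where
  sameEdge-mapEdge : ∀ {e e'} → SameEdge e e' → SameEdge (mapEdge h e) (mapEdge h e')
  sameEdge-mapEdge (inj₁ refl) = inj₁ refl
  sameEdge-mapEdge (inj₂ refl) = inj₂ refl

copies-length≤1 : ∀ {n} {e : Edge n} {J} → Distinct J → All (λ j → SameEdge j e) J → length J ≤ 1
copies-length≤1 [] [] = z≤n
copies-length≤1 (_ ∷ []) (_ ∷ []) = ≤-refl
copies-length≤1 ((j≉j' ∷ _) ∷ _) (j≈e ∷ j'≈e ∷ _) = ⊥-elim (j≉j' (same j≈e j'≈e))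
  where
  same : ∀ {j j' e} → SameEdge j e → SameEdge j' e → SameEdge j j'
  same (inj₁ refl) (inj₁ refl) = inj₁ refl
  same (inj₁ refl) (inj₂ refl) = inj₂ refl
  same (inj₂ refl) (inj₁ refl) = inj₂ refl
  same (inj₂ refl) (inj₂ refl) = inj₁ refl

AllPairs-resp-⊇ : ∀ {A : Set} {R : A → A → Set} {xs ys} → xs ⊆ ys → AllPairs R ys → AllPairs R xs
AllPairs-resp-⊇ []         []         = []
AllPairs-resp-⊇ (_ ∷ʳ xs⊆) (_ ∷ ys!)  = AllPairs-resp-⊇ xs⊆ ys!
AllPairs-resp-⊇ (refl ∷ xs⊆) (y~ys ∷ ys!) = All-resp-⊆ xs⊆ y~ys ∷ AllPairs-resp-⊇ xs⊆ ys!

load-mono-⊆ : ∀ {n} (v : Fin n) {E' E} → E' ⊆ E → load v E' ≤ load v E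
load-mono-⊆ v [] = z≤n
load-mono-⊆ v (e ∷ʳ E'⊆) = ≤-trans (load-mono-⊆ v E'⊆) (load-∷-≤ v e _)
load-mono-⊆ v (_∷_ {x = e} refl E'⊆) with touches v e
... | true  = s≤s (load-mono-⊆ v E'⊆)
... | false = load-mono-⊆ v E'⊆

trim : ∀ {n} (v : Fin n) k {m} F → load v F ≤ k + m →
  ∃ λ E → E ⊆ F × load v E ≤ m × length F ≤ k + length E
trim v zero F le = F , ⊆-refl , le , ≤-refl
trim v (suc k) [] le = [] , [] , z≤n , z≤n
trim v (suc k) {m} (e ∷ F) le with touches v e in hit
... | true  = let E , E⊆F , ≤m , len = trim v k F (≤-pred le)
              in E , e ∷ʳ E⊆F , ≤m , s≤s len
... | false = let E , E⊆F , ≤m , len = trim v (suc k) F le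
              in e ∷ E , refl ∷ E⊆F , subst (_≤ m) (sym (load-∷-¬touching v e E hit)) ≤m ,
                 ≤-trans (s≤s len) (≤-reflexive (sym (+-suc (suc k) (length E))))

load-interleaving : ∀ {n} (v : Fin n) {J F E} → Interleaving J F E → load v E ≡ load v J + load v F
load-interleaving v [] = refl
load-interleaving v {E = e ∷ _} (consˡ il) with touches v e
... | true  = cong suc (load-interleaving v il)
... | false = load-interleaving v il
load-interleaving v {J} {E = e ∷ _} (consʳ il) with touches v e
... | true  = trans (cong suc (load-interleaving v il)) (sym (+-suc (load v J) _))
... | false = load-interleaving v il

interleaving⇒⊆ʳ : ∀ {A : Set} {J F E : List A} → Interleaving J F E → F ⊆ E
interleaving⇒⊆ʳ [] = []
interleaving⇒⊆ʳ (consˡ il) = _ ∷ʳ interleaving⇒⊆ʳ il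
interleaving⇒⊆ʳ (consʳ il) = refl ∷ interleaving⇒⊆ʳ il

partition-image : ∀ {A B : Set} {P : A → Set} (h : B → A) {E} → All (λ e → P e ⊎ ∃ λ b → h b ≡ e) E →
  ∃ λ J → ∃ λ F → All P J × Interleaving J (map h F) E
partition-image h [] = [] , [] , [] , []
partition-image h {e ∷ _} (inj₁ Pe ∷ rest) =
  let J , F , PJ , il = partition-image h rest in e ∷ J , F , Pe ∷ PJ , consˡ il
partition-image h (inj₂ (b , refl) ∷ rest) =
  let J , F , PJ , il = partition-image h rest in J , b ∷ F , PJ , consʳ il

matched⇒branch : ∀ t {E} → (∀ v → load v E ≤ deg t v ∸ 2) →
  All (λ e → 3 ≤ deg t (proj₁ e) × 3 ≤ deg t (proj₂ e)) E
matched⇒branch t {[]} _ = []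
matched⇒branch t {(a , b) ∷ E} load≤ =
  (branch (touches-fst a b) , branch (touches-snd a b))
  ∷ matched⇒branch t (λ v → ≤-trans (load-∷-≤ v (a , b) E) (load≤ v))
  where
  branch : ∀ {v} → touches v (a , b) ≡ true → 3 ≤ deg t v
  branch {v} hit = m∸n≢0⇒n<m (m<n⇒n≢0 (subst (_≤ deg t v ∸ 2) (load-∷-touching v (a , b) E hit) (load≤ v)))

excessMatching-starlike-or-path : ∀ t {E} → Starlike t ⊎ IsPath t → ExcessMatching t E → E ≡ []
excessMatching-starlike-or-path t {[]} _ _ = refl
excessMatching-starlike-or-path t {(a , b) ∷ E} shape M
  with matched⇒branch t {(a , b) ∷ E} (ExcessMatching.load≤ M) | ExcessMatching.edges M | shape
... | (3≤a , _) ∷ _ | _ | inj₂ path = ⊥-elim (≤⇒≯ (path a) 3≤a)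
... | (3≤a , 3≤b) ∷ _ | ab ∷ _ | inj₁ (_ , _ , central) with trans (central a 3≤a) (sym (central b 3≤b))
...   | refl = ⊥-elim (¬Adj-refl (graph t) a ab)

excessMatchingNumber-base : ∀ t → Starlike t ⊎ IsPath t → ExcessMatchingNumber t 0
excessMatchingNumber-base t shape = record
  { witness  = []
  ; matching = record { edges = [] ; distinct = [] ; load≤ = λ _ → z≤n }
  ; length≡  = refl
  ; maximal  = λ E M → ≤-reflexive (cong length (excessMatching-starlike-or-path t shape M))
  }

module Split {t s t' : Tree} {vs : V s} {vt : V t'} (σ : Splitting t s t' vs vt) where
  open Splitting σ using (branching; center; isCenter; vsLeaf; vsAdjC; glue)
  open Glued (fromGlue {t} {s} {t'} {vs} {vt} glue) public

  center≢vs : center ≢ vs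
  center≢vs refl = ¬Adj-refl (graph s) center vsAdjC

  g≢f-center : ∀ y → g y ≢ f center
  g≢f-center y eq = f≢g center≢vs y (sym eq)

  deg-g-vt : deg t (g vt) ≡ suc (deg t' vt)
  deg-g-vt = trans deg-junction (cong (_+ deg t' vt) vsLeaf)

  branch-f : ∀ {x} → 3 ≤ deg t (f x) → x ≡ vs ⊎ x ≡ center
  branch-f {x} d≥3 with x ≟ vs
  ... | yes x≡vs = inj₁ x≡vs
  ... | no x≢vs  = inj₂ (proj₂ isCenter x (subst (3 ≤_) (deg-f x≢vs) d≥3))

  -- Otherwise t' is the single vertex vt, and f center would be the only branch vertex of t.
  vt-nonisolated : 1 ≤ deg t' vt
  vt-nonisolated with deg t' vt in d≡ | branching
  ... | suc _ | _ = s≤s z≤n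
  ... | zero  | u , w , u≢w , 3≤u , 3≤w = ⊥-elim (u≢w (trans (only-branch u 3≤u) (sym (only-branch w 3≤w))))
    where
    only-branch : ∀ z → 3 ≤ deg t z → z ≡ f center
    only-branch = ∀-vertex onG onF
      where
      onG : ∀ y → 3 ≤ deg t (g y) → g y ≡ f center
      onG y d≥3 with y ≟ vt
      ... | yes refl with s≤s () ← subst (3 ≤_) (trans deg-g-vt (cong suc d≡)) d≥3
      onG y d≥3 | no y≢vt with () ← subst (1 ≤_) d≡ (nontrivial⇒deg-pos t' (λ vt≡y → y≢vt (sym vt≡y)))
      onF : ∀ x → x ≢ vs → 3 ≤ deg t (f x) → f x ≡ f center
      onF x x≢vs d≥3 = cong f (proj₂ isCenter x (subst (3 ≤_) (deg-f x≢vs) d≥3))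

  leaves-split : leaves s + leaves t' + irregularity t' vt ≡ leaves t + 2
  leaves-split = begin
    leaves s + leaves t' + irregularity t' vt   ≡⟨ +-assoc (leaves s) _ _ ⟩
    leaves s + (leaves t' + irregularity t' vt) ≡⟨ cong₂ _+_ leaves-s (leaves+irregularity t' vt vt-nonisolated) ⟩
    suc X + suc Y                              ≡⟨ cong suc (+-suc X Y) ⟩
    2 + (X + Y)                                ≡⟨ +-comm 2 (X + Y) ⟩
    X + Y + 2                                  ≡⟨ cong (_+ 2) leaves-t ⟨
    leaves t + 2                               ∎
    where
    open ≡-Reasoning
    X = count (without vs (isLeafB s))
    Y = count (without vt (isLeafB t'))
    leaves-s : leaves s ≡ suc X
    leaves-s = count-erase-member (isLeafB s) (trans (isLeafB≡deg≡ᵇ1 s vs) (cong (_≡ᵇ 1) vsLeaf))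
    g-vt-not-leaf : isLeafB t (g vt) ≡ false
    g-vt-not-leaf = trans (isLeafB≡deg≡ᵇ1 t (g vt)) (trans (cong (_≡ᵇ 1) deg-g-vt) (lemma vt-nonisolated))
      where
      lemma : ∀ {d} → 1 ≤ d → (suc d ≡ᵇ 1) ≡ false
      lemma (s≤s _) = refl
    leaves-t : leaves t ≡ X + Y
    leaves-t = count-⊎-image (isLeafB t) f-injective g-injective
      (λ x leaf → let x≢vs , sleaf = without-true (isLeafB s) leaf in trans (isLeafB-f x≢vs) sleaf)
      (λ y leaf → let y≢vt , t'leaf = without-true (isLeafB t') leaf in trans (isLeafB-g y≢vt) t'leaf)
      (λ x y leaf _ fx≡gy → proj₁ (without-true (isLeafB s) leaf) (proj₁ (f≡g⇒junction x y fx≡gy)))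
      (∀-vertex onG onF)
      where
      onG : ∀ y → isLeafB t (g y) ≡ true →
        (∃ λ x → f x ≡ g y × without vs (isLeafB s) x ≡ true) ⊎ (∃ λ z → g z ≡ g y × without vt (isLeafB t') z ≡ true)
      onG y leaf with y ≟ vt
      ... | yes refl with () ← trans (sym g-vt-not-leaf) leaf
      ... | no y≢vt  = inj₂ (y , refl , trans (without-other (isLeafB t') y≢vt) (trans (sym (isLeafB-g y≢vt)) leaf))
      onF : ∀ x → x ≢ vs → isLeafB t (f x) ≡ true →
        (∃ λ x' → f x' ≡ f x × without vs (isLeafB s) x' ≡ true) ⊎ (∃ λ z → g z ≡ f x × without vt (isLeafB t') z ≡ true)
      onF x x≢vs leaf = inj₁ (x , refl , trans (without-other (isLeafB s) x≢vs) (trans (sym (isLeafB-f x≢vs)) leaf))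

  junction : Edge (size t)
  junction = f center , g vt

  IsJunction : Edge (size t) → Set
  IsJunction e = SameEdge e junction

  junction-adjacent : Adj (graph t) (f center) (g vt)
  junction-adjacent = subst (Adj (graph t) (f center)) f-vs≡g-vt (subst T (sym (adj-f center vs)) vsAdjC)

  touches-g-junction : ∀ {y} → y ≢ vt → touches (g y) junction ≡ false
  touches-g-junction {y} y≢vt = touches-≢ (g≢f-center y) (λ gy≡gvt → y≢vt (g-injective gy≡gvt))

  pushforward-image : ∀ {E'} → ExcessMatching t' E' → ExcessMatching t (map (mapEdge g) E')
  pushforward-image {E'} M' = record
    { edges    = All.map⁺ (All.map (λ { {a , b} → subst T (sym (adj-g a b)) }) edges)
    ; distinct = Distinct-map⁺ g-injective distinct
    ; load≤    = ∀-vertex at-g at-f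
    }
    where
    open ExcessMatching M'
    at-g : ∀ y → load (g y) (map (mapEdge g) E') ≤ deg t (g y) ∸ 2
    at-g y with y ≟ vt
    ... | yes refl rewrite load-mapEdge g-injective vt E' | deg-g-vt = ≤-trans (load≤ vt) (∸-monoˡ-≤ 2 (n≤1+n (deg t' vt)))
    ... | no y≢vt  rewrite load-mapEdge g-injective y E' | deg-g y≢vt = load≤ y
    at-f : ∀ x → x ≢ vs → load (f x) (map (mapEdge g) E') ≤ deg t (f x) ∸ 2
    at-f x x≢vs rewrite load-mapEdge-outside (λ y gy≡fx → f≢g x≢vs y (sym gy≡fx)) E' = z≤n

  pushforward-junction : ∀ {E'} → 2 ≤ deg t' vt → ExcessMatching t' E' →
    ExcessMatching t (junction ∷ map (mapEdge g) E')
  pushforward-junction {E'} d≥2 M' = record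
    { edges    = junction-adjacent ∷ edges
    ; distinct = All.map⁺ (All.universal junction-new E') ∷ distinct
    ; load≤    = ∀-vertex at-g at-f
    }
    where
    M = map (mapEdge g) E'
    open ExcessMatching (pushforward-image M')
    junction-new : ∀ e' → ¬ SameEdge junction (mapEdge g e')
    junction-new (a , _) (inj₁ eq) = g≢f-center a (sym (cong proj₁ eq))
    junction-new (_ , b) (inj₂ eq) = g≢f-center b (sym (cong proj₁ eq))
    at-g : ∀ y → load (g y) (junction ∷ M) ≤ deg t (g y) ∸ 2
    at-g y with y ≟ vt
    ... | yes refl rewrite load-∷-touching (g vt) junction M (touches-snd (f center) (g vt))
                         | load-mapEdge g-injective vt E' | deg-g-vt | +-∸-assoc 1 d≥2 =
      s≤s (ExcessMatching.load≤ M' vt)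
    ... | no y≢vt rewrite load-∷-¬touching (g y) junction M (touches-g-junction y≢vt) = load≤ (g y)
    at-f : ∀ x → x ≢ vs → load (f x) (junction ∷ M) ≤ deg t (f x) ∸ 2
    at-f x x≢vs with x ≟ center
    ... | yes refl rewrite load-∷-touching (f center) junction M (touches-fst (f center) (g vt))
                         | load-mapEdge-outside (λ y → g≢f-center y) E' | deg-f center≢vs =
      m<n⇒0<n∸m (proj₁ isCenter)
    ... | no x≢c rewrite load-∷-¬touching (f x) junction M
                           (touches-≢ (λ fx≡fc → x≢c (f-injective fx≡fc)) (f≢g x≢vs vt)) = load≤ (f x)

  pushforward : ∀ {E'} → ExcessMatching t' E' →
    ∃ λ E → ExcessMatching t E × length E ≡ irregularity t' vt + length E'
  pushforward {E'} M' with irregularity-cases t' vt vt-nonisolated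
  ... | inj₁ (_ , irr≡0) =
    map (mapEdge g) E' , pushforward-image M' , trans (length-map _ E') (cong (_+ length E') (sym irr≡0))
  ... | inj₂ (d≥2 , irr≡1) =
    junction ∷ map (mapEdge g) E' , pushforward-junction d≥2 M' ,
    trans (cong suc (length-map _ E')) (cong (_+ length E') (sym irr≡1))

  branch-edge : ∀ {a b} → Adj (graph t) a b → 3 ≤ deg t a → 3 ≤ deg t b →
    IsJunction (a , b) ⊎ ∃ λ e' → mapEdge g e' ≡ (a , b)
  branch-edge ab 3≤a 3≤b with edge-cover _ _ ab
  ... | inj₂ (y , y' , refl , refl) = inj₂ ((y , y') , refl)
  ... | inj₁ (x , x' , refl , refl) with branch-f 3≤a | branch-f 3≤b
  ...   | inj₁ refl | inj₁ refl = ⊥-elim (¬Adj-refl (graph t) _ ab)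
  ...   | inj₂ refl | inj₂ refl = ⊥-elim (¬Adj-refl (graph t) _ ab)
  ...   | inj₂ refl | inj₁ refl = inj₁ (inj₁ (cong (f center ,_) f-vs≡g-vt))
  ...   | inj₁ refl | inj₂ refl = inj₁ (inj₂ (cong (_, f center) f-vs≡g-vt))

  classify : ∀ {E} → ExcessMatching t E → All (λ e → IsJunction e ⊎ ∃ λ e' → mapEdge g e' ≡ e) E
  classify M = All.zipWith (λ { (ab , 3≤a , 3≤b) → branch-edge ab 3≤a 3≤b }) (edges , matched⇒branch t load≤)
    where open ExcessMatching M

  record Restriction (E : List (Edge (size t))) : Set where
    field
      junctions   : ℕ
      rest        : List (Edge (size t'))
      length≡     : length E ≡ junctions + length rest
      junctions≤1 : junctions ≤ 1
      rest-edges    : All (uncurry (Adj (graph t'))) rest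
      rest-distinct : Distinct rest
      rest-load≤    : ∀ {y} → y ≢ vt → load y rest ≤ deg t' y ∸ 2
      rest-load≤-vt : junctions + load vt rest ≤ irregularity t' vt + (deg t' vt ∸ 2)

  restrict : ∀ {E} → ExcessMatching t E → Restriction E
  restrict {E} M with partition-image (mapEdge g) (classify M)
  ... | J , F , J≈ , il = record
    { junctions     = length J
    ; rest          = F
    ; length≡       = trans (interleave-length il) (cong (_+_ (length J)) (length-map _ F))
    ; junctions≤1   = copies-length≤1 (AllPairs-resp-⊇ (interleaving⇒⊆ʳ (Interleaving.swap il)) distinct) J≈
    ; rest-edges    = All.map (λ { {a , b} → subst T (adj-g a b) }) (All.map⁻ (All-resp-⊆ F⊆E edges))
    ; rest-distinct = Distinct-map⁻ (AllPairs-resp-⊇ F⊆E distinct)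
    ; rest-load≤    = λ {y} y≢vt → subst₂ _≤_ (load-g y≢vt) (cong (_∸ 2) (deg-g y≢vt)) (load≤ (g y))
    ; rest-load≤-vt = subst₂ _≤_ load-vt (trans (cong (_∸ 2) deg-g-vt) (suc[deg]∸2≡irregularity+[deg∸2] t' vt)) (load≤ (g vt))
    }
    where
    open ExcessMatching M
    F⊆E = interleaving⇒⊆ʳ il
    load-g : ∀ {y} → y ≢ vt → load (g y) E ≡ load y F
    load-g {y} y≢vt = begin
      load (g y) E                                  ≡⟨ load-interleaving (g y) il ⟩
      load (g y) J + load (g y) (map (mapEdge g) F) ≡⟨ cong₂ _+_ (load-copies-¬touching (g y) J≈ (touches-g-junction y≢vt))
                                                                (load-mapEdge g-injective y F) ⟩
      load y F                                      ∎
      where open ≡-Reasoning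
    load-vt : load (g vt) E ≡ length J + load vt F
    load-vt = begin
      load (g vt) E                                   ≡⟨ load-interleaving (g vt) il ⟩
      load (g vt) J + load (g vt) (map (mapEdge g) F) ≡⟨ cong₂ _+_ (load-copies-touching (g vt) J≈ (touches-snd (f center) (g vt)))
                                                                  (load-mapEdge g-injective vt F) ⟩
      length J + load vt F                            ∎
      where open ≡-Reasoning

  -- Without a junction edge (j = 0), vt may exceed its bound in t' by the irregularity; trimming that many
  -- edges at vt repairs it.
  shrink : ∀ {F} j → j ≤ 1 → j + load vt F ≤ irregularity t' vt + (deg t' vt ∸ 2) →
    ∃ λ E' → E' ⊆ F × load vt E' ≤ deg t' vt ∸ 2 × j + length F ≤ irregularity t' vt + length E'
  shrink {F} zero _ le = trim vt (irregularity t' vt) F le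
  shrink {F} (suc zero) _ le with irregularity-cases t' vt vt-nonisolated
  ... | inj₁ (d≡1 , irr≡0) with () ← subst (suc (load vt F) ≤_) (cong₂ (λ i d → i + (d ∸ 2)) irr≡0 d≡1) le
  ... | inj₂ (_ , irr≡1) rewrite irr≡1 = F , ⊆-refl , ≤-pred le , ≤-refl
  shrink (suc (suc _)) (s≤s ()) _

  pullback : ∀ {E} → ExcessMatching t E →
    ∃ λ E' → ExcessMatching t' E' × length E ≤ irregularity t' vt + length E'
  pullback M with restrict M
  ... | R with shrink (Restriction.junctions R) (Restriction.junctions≤1 R) (Restriction.rest-load≤-vt R)
  ...   | E' , E'⊆rest , vt-load≤ , len = E' , M' , subst (_≤ _) (sym (length≡ R)) len
    where
    open Restriction
    M' : ExcessMatching t' E'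
    M' = record
      { edges    = All-resp-⊆ E'⊆rest (rest-edges R)
      ; distinct = AllPairs-resp-⊇ E'⊆rest (rest-distinct R)
      ; load≤    = bounded
      }
      where
      bounded : ∀ y → load y E' ≤ deg t' y ∸ 2
      bounded y with y ≟ vt
      ... | yes refl = vt-load≤
      ... | no y≢vt  = ≤-trans (load-mono-⊆ y E'⊆rest) (rest-load≤ R y≢vt)

  excessMatchingNumber-split : ∀ {m} → ExcessMatchingNumber t' m → ExcessMatchingNumber t (irregularity t' vt + m)
  excessMatchingNumber-split ν' = record
    { witness  = proj₁ pushed
    ; matching = proj₁ (proj₂ pushed)
    ; length≡  = trans (proj₂ (proj₂ pushed)) (cong (_+_ (irregularity t' vt)) length≡)
    ; maximal  = λ E M → let E' , M' , len = pullback M in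
                   ≤-trans len (+-monoʳ-≤ (irregularity t' vt) (maximal E' M'))
    }
    where
    open ExcessMatchingNumber ν'
    pushed = pushforward matching

leafExcess-step : ∀ a b c i j → a + b + i ≡ c + 2 →
  (+ a - + 2) ℤ.+ ((+ b - + 2) - + j) ≡ (+ c - + 2) - + (i + j)
leafExcess-step a b c i j eq = begin
  (+ a - + 2) ℤ.+ ((+ b - + 2) - + j)     ≡⟨ regroup (+ a) (+ b) (+ i) (+ j) ⟩
  (+ a ℤ.+ + b ℤ.+ + i) - + 4 - + i - + j ≡⟨ cong (λ z → z - + 4 - + i - + j) lifted ⟩
  (+ c ℤ.+ + 2) - + 4 - + i - + j         ≡⟨ collect (+ c) (+ i) (+ j) ⟩
  (+ c - + 2) - (+ i ℤ.+ + j)             ≡⟨ cong ((+ c - + 2) -_) (pos-+ i j) ⟨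
  (+ c - + 2) - + (i + j)                 ∎
  where
  open ≡-Reasoning
  regroup : ∀ A B I J → (A - + 2) ℤ.+ ((B - + 2) - J) ≡ (A ℤ.+ B ℤ.+ I) - + 4 - I - J
  regroup = solve-∀
  collect : ∀ C I J → (C ℤ.+ + 2) - + 4 - I - J ≡ (C - + 2) - (I ℤ.+ J)
  collect = solve-∀
  lifted : + a ℤ.+ + b ℤ.+ + i ≡ + c ℤ.+ + 2
  lifted = begin
    + a ℤ.+ + b ℤ.+ + i ≡⟨ cong (ℤ._+ + i) (pos-+ a b) ⟨
    + (a + b) ℤ.+ + i   ≡⟨ pos-+ (a + b) i ⟨
    + (a + b + i)       ≡⟨ cong +_ eq ⟩
    + (c + 2)           ≡⟨ pos-+ c 2 ⟩
    + c ℤ.+ + 2         ∎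

leafExcess-decomp : ∀ {t Ss ι} → Decomp t Ss ι → leafExcess Ss ≡ (+ leaves t - + 2) - + ι
leafExcess-decomp (base-star _) = refl
leafExcess-decomp (base-path _) = refl
leafExcess-decomp {t} (split {s = s} {t'} {vt = vt} {ι = ι} σ D) =
  trans (cong (ℤ._+_ (+ leaves s - + 2)) (leafExcess-decomp D))
        (leafExcess-step (leaves s) (leaves t') (leaves t) (irregularity t' vt) ι (Split.leaves-split σ))

excessMatchingNumber-decomp : ∀ {t Ss ι} → Decomp t Ss ι → ExcessMatchingNumber t ι
excessMatchingNumber-decomp (base-star starlike) = excessMatchingNumber-base _ (inj₁ starlike)
excessMatchingNumber-decomp (base-path path)     = excessMatchingNumber-base _ (inj₂ path)
excessMatchingNumber-decomp (split σ D)          = Split.excessMatchingNumber-split σ (excessMatchingNumber-decomp D)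

proposition5p1 : (t : Tree) (Ss : List Tree) (ι : ℕ) → Decomp t Ss ι →
    (leafExcess Ss ≡ (+ leaves t - + 2) - + ι)
    × (∀ (Ss′ : List Tree) (ι′ : ℕ) → Decomp t Ss′ ι′ → leafExcess Ss ≡ leafExcess Ss′)
    × (∀ (Ss′ : List Tree) (ι′ : ℕ) → Decomp t Ss′ ι′ → ι ≡ ι′)
proposition5p1 t Ss ι D = leafExcess-decomp D , excess-invariant , ι-invariant
  where
  ι-invariant : ∀ Ss′ ι′ → Decomp t Ss′ ι′ → ι ≡ ι′
  ι-invariant _ _ D′ = excessMatchingNumber-unique (excessMatchingNumber-decomp D) (excessMatchingNumber-decomp D′)
  excess-invariant : ∀ Ss′ ι′ → Decomp t Ss′ ι′ → leafExcess Ss ≡ leafExcess Ss′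
  excess-invariant Ss′ ι′ D′ = begin
    leafExcess Ss             ≡⟨ leafExcess-decomp D ⟩
    (+ leaves t - + 2) - + ι  ≡⟨ cong (λ k → (+ leaves t - + 2) - + k) (ι-invariant Ss′ ι′ D′) ⟩
    (+ leaves t - + 2) - + ι′ ≡⟨ leafExcess-decomp D′ ⟨
    leafExcess Ss′            ∎
    where open ≡-Reasoning
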